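{- Let $M$ and $N$ be matroids with $T=E(M)\cap E(N)$ nonempty, and assume that $T$ is independent in both $M$ and $N$. Fix $F\subseteq E(M)\cup E(N)$ such that $F_M=F\cap E(M)$ is a flat of $M$ and $F_N=F\cap E(N)$ is a flat of $N$. If $(F_M,T)$ is a modular pair in $M$ and $(F_N,T)$ is a modular pair in $N$, then $F$ is a flat of $B_T(M,N)$. In particular, if $|T-F|\leq 1$, then $F$ is a flat of $B_T(M,N)$.
   Context: A pair $(X,Y)$ of subsets is a modular pair in a matroid if $r(X)+r(Y)=r(X\cup Y)+r(X\cap Y)$. Bonding: let $T=\{t_1,\ldots,t_k\}$, and fix sets $S=\{s_1,\ldots,s_k\}$ and $Q=\{q_1,\ldots,q_k\}$ disjoint from each other and from $E(M)\cup E(N)$. Form $N'$ from $N$ by relabeling each $t_i$ as $s_i$. Form $H$ from $M\oplus N'$ by, for each $i\in[k]$, adding $q_i$ freely to the flat $\mathrm{cl}_{M\oplus N'}(\{t_i,s_i\})$, i.e., taking the principal extension $L+_Xq$ with $X=\mathrm{cl}(\{t_i,s_i\})$, whose rank function is $r'(Y)=r_L(Y)$ and $r'(Y\cup q)=r_L(Y)$ if $X\subseteq \mathrm{cl}_L(Y)$, $r_L(Y)+1$ otherwise (the order of these extensions does not matter). Then $B_T(M,N)=H/Q\backslash S$, a matroid on $E(M)\cup E(N)$. -}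

module Defs where

open import Data.Nat using (ℕ; _≤_; _<_; _+_; _∸_; _≡ᵇ_)
open import Data.Bool using (Bool; true; false; if_then_else_; _∧_)
open import Data.Fin using (Fin)
open import Data.Vec using (lookup; tabulate)
open import Data.List using (List; foldr; allFin)
open import Data.Product using (_×_)
open import Relation.Binary.PropositionalEquality using (_≡_)
open import Data.Fin.Subset
  using (Subset; _∈_; _∉_; _⊆_; _∩_; _∪_; _─_; ⁅_⁆; ∣_∣; _-_)
  renaming (⊥ to ∅)

record Matroid (n : ℕ) : Set where
  field
    E    : Subset n
    rank : Subset n → ℕ
    rank-≤-card : ∀ X → X ⊆ E → rank X ≤ ∣ X ∣
    rank-mono   : ∀ X Y → X ⊆ Y → Y ⊆ E → rank X ≤ rank Y
    rank-submod : ∀ X Y → X ⊆ E → Y ⊆ E →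
                  rank (X ∪ Y) + rank (X ∩ Y) ≤ rank X + rank Y

open Matroid public

Indep : ∀ {n} → Matroid n → Subset n → Set
Indep M X = X ⊆ E M × rank M X ≡ ∣ X ∣

IsFlatR : ∀ {n} → Subset n → (Subset n → ℕ) → Subset n → Set
IsFlatR E r F = F ⊆ E × (∀ e → e ∈ E → e ∉ F → r F < r (F ∪ ⁅ e ⁆))

IsFlat : ∀ {n} → Matroid n → Subset n → Set
IsFlat M F = IsFlatR (E M) (rank M) F

ModularPair : ∀ {n} → Matroid n → Subset n → Subset n → Set
ModularPair M X Y = rank M X + rank M Y ≡ rank M (X ∪ Y) + rank M (X ∩ Y)

-- The auxiliary matroid H lives on the universe
-- (original elements) ⊎ (copies s_t) ⊎ (copies q_t), indexed by Fin n
-- each; only s_t, q_t with t ∈ T are ever used.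

record Sub3 (n : ℕ) : Set where
  constructor ⟨_,_,_⟩
  field
    o s q : Subset n

open Sub3 public

_∪₃_ : ∀ {n} → Sub3 n → Sub3 n → Sub3 n
A ∪₃ B = ⟨ o A ∪ o B , s A ∪ s B , q A ∪ q B ⟩

module Bonding {n : ℕ} (M N : Matroid n) where

  T : Subset n
  T = E M ∩ E N

  -- rank of M ⊕ N', where N' is N with each t ∈ T relabelled s_t
  -- (the q-part is ignored: M ⊕ N' has no q-elements)
  r₀ : Sub3 n → ℕ
  r₀ Z = rank M (o Z ∩ E M) + rank N ((o Z ∩ (E N ─ T)) ∪ (s Z ∩ T))

  E₀ : Sub3 n
  E₀ = ⟨ E M ∪ (E N ─ T) , T , ∅ ⟩

  cl₀ : Sub3 n → Sub3 n
  cl₀ A = ⟨ tabulate (λ i → lookup (o E₀) i ∧ (r₀ (A ∪₃ ⟨ ⁅ i ⁆ , ∅ , ∅ ⟩) ≡ᵇ r₀ A))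
          , tabulate (λ i → lookup (s E₀) i ∧ (r₀ (A ∪₃ ⟨ ∅ , ⁅ i ⁆ , ∅ ⟩) ≡ᵇ r₀ A))
          , ∅ ⟩

  Xflat : Fin n → Sub3 n
  Xflat t = cl₀ ⟨ ⁅ t ⁆ , ⁅ t ⁆ , ∅ ⟩

  -- principal extension L +_X q_t of a matroid with rank function r
  -- (r being defined on sets not containing q_t)
  ext : (Sub3 n → ℕ) → Fin n → Sub3 n → ℕ
  ext r t Z with lookup (q Z) t
  ... | false = r Z
  ... | true  = let Y = ⟨ o Z , s Z , q Z - t ⟩ in
                r Y + (if r (Y ∪₃ Xflat t) ≡ᵇ r Y then 0 else 1)

  -- H: add q_t freely to cl({t, s_t}) for each t ∈ T
  rH : Sub3 n → ℕ
  rH = foldr (λ t r → if lookup T t then ext r t else r) r₀ (allFin n)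

  -- B_T(M,N) = H / Q \ S, on ground set E(M) ∪ E(N)
  EB : Subset n
  EB = E M ∪ E N

  rB : Subset n → ℕ
  rB X = rH ⟨ X ∩ EB , ∅ , T ⟩ ∸ rH ⟨ ∅ , ∅ , T ⟩

open Bonding public using (T; EB; rB)

IsFlatBond : ∀ {n} → Matroid n → Matroid n → Subset n → Set
IsFlatBond M N F = IsFlatR (EB M N) (rB M N) F

{-# OPTIONS --safe #-}

-- Write ρₘ = r_M(F_M), ρₙ = r_N(F_N) and δ = |T − F|.  In H the principal extension
-- has the form r(Y + q_t) = min(r(Y ∪ cl{t, s_t}), r(Y) + 1).  Upper bound: for
-- Y ⊆ F ∪ s(F) ∪ Q, every q_t ∈ Y with t ∈ F can be exchanged for cl{t, s_t}, which stays
-- inside F ∪ s(F) because F_M and F_N are flats, and every other q_t adds at most 1;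
-- so r_H(F ∪ Q) ≤ ρₘ + ρₙ + δ.  Lower bound: replacing a q_t by t or by s_t
-- never increases rank, since both lie in cl{t, s_t} and add at most 1.  For e ∉ F this
-- gives r_H(F ∪ e ∪ Q) ≥ r_M(F_M ∪ e) + r_N(F_N ∪ T) when e ∈ E(M), and
-- r_M(F_M ∪ T) + r_N(F_N ∪ e) otherwise.  Both exceed ρₘ + ρₙ + δ, by flatness for e and
-- by r(F_X ∪ T) ≥ r(F_X) + |T − F|, which holds for a modular pair with T independent,
-- and trivially when |T − F| ≤ 1.

module Submission where

open import Defs
open import Data.Bool using (true; false; if_then_else_; _∧_)
open import Data.Bool.Properties using (T-≡)
open import Data.Empty using (⊥-elim)
open import Data.Fin as Fin using (Fin; _≟_)
open import Data.Fin.Subset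
  using (Subset; Nonempty; _∈_; _∉_; _⊆_; _∩_; _∪_; _─_; _-_; ⁅_⁆; ∣_∣)
  renaming (⊥ to ∅)
open import Data.Fin.Subset.Properties
  using (_∈?_; nonempty?; ∉⊥; x∈⁅x⁆; x∈⁅y⁆⇒x≡y; x∈p∪q⁺; x∈p∪q⁻; x∈p∩q⁺; x∈p∩q⁻;
         x∈p∧x∉q⇒x∈p─q; x∈p∧x≢y⇒x∈p-y; p⊆q⇒∣p∣≤∣q∣; x∈p⇒∣p-x∣<∣p∣;
         Empty-unique; ∣⊥∣≡0; ∣⁅x⁆∣≡1; ∩-comm; p∩q⊆p; p∩q⊆q; p─q⊆p)
open import Data.List using (List; []; _∷_; foldr; allFin)
open import Data.List.Membership.Propositional using () renaming (_∈_ to _∈ₗ_)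
open import Data.List.Membership.Propositional.Properties using (∈-allFin)
open import Data.List.Relation.Unary.Any using (here; there)
open import Data.List.Relation.Unary.Any.Properties using (¬Any[])
open import Data.Nat using (ℕ; suc; _≤_; _<_; _+_; _⊓_; _≡ᵇ_; s≤s)
open import Data.Nat.Properties hiding (_≟_)
open import Data.Product using (_×_; _,_; proj₁; proj₂)
open import Data.Sum using (_⊎_; inj₁; inj₂; [_,_]′)
open import Data.Vec using ([]; _∷_; here; there; lookup; tabulate)
open import Data.Vec.Properties using ([]=⇒lookup; lookup⇒[]=; lookup∘tabulate)
open import Function using (_∘_; case_of_; Equivalence)
open import Relation.Nullary using (Dec; yes; no; contradiction)
open import Relation.Binary.PropositionalEquality

private
  variable
    n : ℕ
    A B C : Subset n
    x : Fin n

∈∪ˡ : x ∈ A → x ∈ A ∪ B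
∈∪ˡ = x∈p∪q⁺ ∘ inj₁

∈∪ʳ : x ∈ B → x ∈ A ∪ B
∈∪ʳ = x∈p∪q⁺ ∘ inj₂

∈∪⁻ : x ∈ A ∪ B → x ∈ A ⊎ x ∈ B
∈∪⁻ = x∈p∪q⁻ _ _

x∈p∪q∧x∉q⇒x∈p : x ∈ A ∪ B → x ∉ B → x ∈ A
x∈p∪q∧x∉q⇒x∈p x∈A∪B x∉B = [ (λ x∈A → x∈A) , (λ x∈B → contradiction x∈B x∉B) ]′ (∈∪⁻ x∈A∪B)

∈∩ˡ : x ∈ A ∩ B → x ∈ A
∈∩ˡ = proj₁ ∘ x∈p∩q⁻ _ _

∈∩ʳ : x ∈ A ∩ B → x ∈ B
∈∩ʳ = proj₂ ∘ x∈p∩q⁻ _ _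

∈∩⁺ : x ∈ A → x ∈ B → x ∈ A ∩ B
∈∩⁺ x∈p x∈q = x∈p∩q⁺ (x∈p , x∈q)

x∈p─q⁻ : ∀ (p q : Subset n) → x ∈ p ─ q → x ∈ p × x ∉ q
x∈p─q⁻ (true ∷ p)  (false ∷ q) here = here , λ ()
x∈p─q⁻ {x = Fin.zero} (true ∷ p)  (true ∷ q) ()
x∈p─q⁻ {x = Fin.zero} (false ∷ p) (true ∷ q)  ()
x∈p─q⁻ {x = Fin.zero} (false ∷ p) (false ∷ q) ()
x∈p─q⁻ (_ ∷ p) (_ ∷ q) (there x∈) with x∈p─q⁻ p q x∈
... | x∈p , x∉q = there x∈p , λ { (there x∈q) → x∉q x∈q }

∈─ˡ : x ∈ A ─ B → x ∈ A
∈─ˡ = proj₁ ∘ x∈p─q⁻ _ _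

∈─ʳ : x ∈ A ─ B → x ∉ B
∈─ʳ = proj₂ ∘ x∈p─q⁻ _ _

∈-⁻ : ∀ {y} → x ∈ A - y → x ∈ A × x ≢ y
∈-⁻ {y = y} x∈ = ∈─ˡ x∈ , λ { refl → ∈─ʳ x∈ (x∈⁅x⁆ y) }

∪-lub : A ⊆ C → B ⊆ C → A ∪ B ⊆ C
∪-lub A⊆C B⊆C x∈ with ∈∪⁻ x∈
... | inj₁ x∈A = A⊆C x∈A
... | inj₂ x∈B = B⊆C x∈B

⁅⁆⊆ : x ∈ A → ⁅ x ⁆ ⊆ A
⁅⁆⊆ {x = x} x∈A y∈ rewrite x∈⁅y⁆⇒x≡y x y∈ = x∈A

∈⇒≡⊎∈- : ∀ {y} → x ∈ A → x ≡ y ⊎ x ∈ A - y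
∈⇒≡⊎∈- {x = x} {y = y} x∈A with x ≟ y
... | yes x≡y = inj₁ x≡y
... | no  x≢y = inj₂ (x∈p∧x≢y⇒x∈p-y x∈A x≢y)

∪⊆[∪∪]∪- : ∀ {y} → y ∈ C → A ∪ B ⊆ (A ∪ C) ∪ (B - y)
∪⊆[∪∪]∪- y∈C = ∪-lub (∈∪ˡ ∘ ∈∪ˡ) λ x∈B → [ (λ { refl → ∈∪ˡ (∈∪ʳ y∈C) }) , ∈∪ʳ ]′ (∈⇒≡⊎∈- x∈B)

∪⊆[∪-]∪⁅⁆ : ∀ {y} → A ∪ B ⊆ (A ∪ (B - y)) ∪ ⁅ y ⁆
∪⊆[∪-]∪⁅⁆ {y = y} = ∪-lub (∈∪ˡ ∘ ∈∪ˡ) λ x∈B → [ (λ { refl → ∈∪ʳ (x∈⁅x⁆ y) }) , ∈∪ˡ ∘ ∈∪ʳ ]′ (∈⇒≡⊎∈- x∈B)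

∪⊆∪- : ∀ {y} → y ∉ B → A ∪ B ⊆ A ∪ (B - y)
∪⊆∪- y∉B = ∪-lub ∈∪ˡ λ x∈B → [ (λ { refl → contradiction x∈B y∉B }) , ∈∪ʳ ]′ (∈⇒≡⊎∈- x∈B)

∣p∩q∣+∣p─q∣≡∣p∣ : ∀ (p q : Subset n) → ∣ p ∩ q ∣ + ∣ p ─ q ∣ ≡ ∣ p ∣
∣p∩q∣+∣p─q∣≡∣p∣ []         []         = refl
∣p∩q∣+∣p─q∣≡∣p∣ (true ∷ p)  (true ∷ q)  = cong suc (∣p∩q∣+∣p─q∣≡∣p∣ p q)
∣p∩q∣+∣p─q∣≡∣p∣ (true ∷ p)  (false ∷ q) = trans (+-suc _ _) (cong suc (∣p∩q∣+∣p─q∣≡∣p∣ p q))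
∣p∩q∣+∣p─q∣≡∣p∣ (false ∷ p) (true ∷ q)  = ∣p∩q∣+∣p─q∣≡∣p∣ p q
∣p∩q∣+∣p─q∣≡∣p∣ (false ∷ p) (false ∷ q) = ∣p∩q∣+∣p─q∣≡∣p∣ p q

∣p─r∣≤∣q─r∣ : ∀ (p q r : Subset n) → p ⊆ q → ∣ p ─ r ∣ ≤ ∣ q ─ r ∣
∣p─r∣≤∣q─r∣ p q r p⊆q =
  p⊆q⇒∣p∣≤∣q∣ {p = p ─ r} {q = q ─ r} (λ x∈ → x∈p∧x∉q⇒x∈p─q (p⊆q (∈─ˡ x∈)) (∈─ʳ x∈))

∣p─q∩r∣≤∣p─q∣ : ∀ (p q r : Subset n) → p ⊆ r → ∣ p ─ (q ∩ r) ∣ ≤ ∣ p ─ q ∣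
∣p─q∩r∣≤∣p─q∣ p q r p⊆r = p⊆q⇒∣p∣≤∣q∣ {p = p ─ (q ∩ r)} {q = p ─ q} λ x∈ →
  x∈p∧x∉q⇒x∈p─q (∈─ˡ x∈) (λ x∈q → ∈─ʳ x∈ (∈∩⁺ x∈q (p⊆r (∈─ˡ x∈))))

∣p-x─q∣<∣p─q∣ : ∀ (p q : Subset n) → x ∈ p → x ∉ q → ∣ (p - x) ─ q ∣ < ∣ p ─ q ∣
∣p-x─q∣<∣p─q∣ {x = x} p q x∈p x∉q = ≤-<-trans
  (p⊆q⇒∣p∣≤∣q∣ {p = (p - x) ─ q} {q = (p ─ q) - x} λ y∈ →
     let y∈p , y≢x = ∈-⁻ (∈─ˡ y∈) in x∈p∧x≢y⇒x∈p-y (x∈p∧x∉q⇒x∈p─q y∈p (∈─ʳ y∈)) y≢x)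
  (x∈p⇒∣p-x∣<∣p∣ (x∈p∧x∉q⇒x∈p─q x∈p x∉q))

∈-tabulate-≡ᵇ : ∀ {f : Fin n → ℕ} {c} →
  x ∈ tabulate (λ i → lookup A i ∧ (f i ≡ᵇ c)) → x ∈ A × f x ≡ c
∈-tabulate-≡ᵇ {x = x} {A = A} {f} {c} x∈
  with lookup A x in x∈A | f x ≡ᵇ c in fx≡c
     | trans (sym (lookup∘tabulate (λ i → lookup A i ∧ (f i ≡ᵇ c)) x)) ([]=⇒lookup x∈)
... | true | true | _ = lookup⇒[]= x A x∈A , ≡ᵇ⇒≡ (f x) c (Equivalence.from T-≡ fx≡c)

∈-tabulate-≡ᵇ⁺ : ∀ {f : Fin n → ℕ} {c} →
  x ∈ A → f x ≡ c → x ∈ tabulate (λ i → lookup A i ∧ (f i ≡ᵇ c))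
∈-tabulate-≡ᵇ⁺ {x = x} {A = A} {f} {c} x∈A fx≡c = lookup⇒[]= x _ (begin
  lookup (tabulate (λ i → lookup A i ∧ (f i ≡ᵇ c))) x  ≡⟨ lookup∘tabulate _ x ⟩
  lookup A x ∧ (f x ≡ᵇ c)                             ≡⟨ cong₂ _∧_ ([]=⇒lookup x∈A) (Equivalence.to T-≡ (≡⇒≡ᵇ (f x) c fx≡c)) ⟩
  true                                                 ∎)
  where open ≡-Reasoning

module _ {n} (M : Matroid n) where

  rank-∪⁅⁆ : ∀ {X x} → X ⊆ E M → x ∈ E M → rank M (X ∪ ⁅ x ⁆) ≤ suc (rank M X)
  rank-∪⁅⁆ {X} {x} X⊆E x∈E = begin
    rank M (X ∪ ⁅ x ⁆)                       ≤⟨ m≤m+n _ _ ⟩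
    rank M (X ∪ ⁅ x ⁆) + rank M (X ∩ ⁅ x ⁆)  ≤⟨ rank-submod M X ⁅ x ⁆ X⊆E (⁅⁆⊆ x∈E) ⟩
    rank M X + rank M ⁅ x ⁆                  ≤⟨ +-monoʳ-≤ (rank M X) (rank-≤-card M ⁅ x ⁆ (⁅⁆⊆ x∈E)) ⟩
    rank M X + ∣ ⁅ x ⁆ ∣                     ≡⟨ cong (rank M X +_) (∣⁅x⁆∣≡1 x) ⟩
    rank M X + 1                             ≡⟨ +-comm (rank M X) 1 ⟩
    suc (rank M X)                           ∎
    where open ≤-Reasoning

  -- A set W ⊆ G of the same rank as P ⊇ W spans P, and G is closed.
  flat-absorbs : ∀ {G W P} → IsFlat M G → W ⊆ G → W ⊆ P → P ⊆ E M →
                 rank M P ≤ rank M W → P ⊆ G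
  flat-absorbs {G} {W} {P} (G⊆E , G-closed) W⊆G W⊆P P⊆E rP≤rW {i} i∈P with i ∈? G
  ... | yes i∈G = i∈G
  ... | no  i∉G = contradiction (G-closed i (P⊆E i∈P) i∉G) (≤⇒≯ (+-cancelʳ-≤ (rank M W) _ _ (begin
    rank M (G ∪ ⁅ i ⁆) + rank M W       ≤⟨ +-mono-≤ (rank-mono M _ _ Gi⊆G∪P G∪P⊆E)
                                                    (rank-mono M _ _ (λ w → ∈∩⁺ (W⊆G w) (W⊆P w)) (G⊆E ∘ ∈∩ˡ)) ⟩
    rank M (G ∪ P) + rank M (G ∩ P)     ≤⟨ rank-submod M G P G⊆E P⊆E ⟩
    rank M G + rank M P                 ≤⟨ +-monoʳ-≤ (rank M G) rP≤rW ⟩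
    rank M G + rank M W                 ∎)))
    where
    open ≤-Reasoning
    G∪P⊆E : G ∪ P ⊆ E M
    G∪P⊆E = ∪-lub G⊆E P⊆E
    Gi⊆G∪P : G ∪ ⁅ i ⁆ ⊆ G ∪ P
    Gi⊆G∪P = ∪-lub ∈∪ˡ (∈∪ʳ ∘ ⁅⁆⊆ i∈P)

  FreeOver : Subset n → Subset n → Set
  FreeOver G S = rank M G + ∣ S ─ G ∣ ≤ rank M (G ∪ S)

  modular⇒freeOver : ∀ {G S} → Indep M S → ModularPair M G S → FreeOver G S
  modular⇒freeOver {G} {S} (S⊆E , rS≡∣S∣) modular = +-cancelʳ-≤ ∣ S ∩ G ∣ _ _ (begin
    rank M G + ∣ S ─ G ∣ + ∣ S ∩ G ∣      ≡⟨ +-assoc (rank M G) _ _ ⟩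
    rank M G + (∣ S ─ G ∣ + ∣ S ∩ G ∣)    ≡⟨ cong (rank M G +_) (trans (+-comm ∣ S ─ G ∣ ∣ S ∩ G ∣) (∣p∩q∣+∣p─q∣≡∣p∣ S G)) ⟩
    rank M G + ∣ S ∣                      ≡⟨ cong (rank M G +_) (sym rS≡∣S∣) ⟩
    rank M G + rank M S                   ≡⟨ modular ⟩
    rank M (G ∪ S) + rank M (G ∩ S)       ≤⟨ +-monoʳ-≤ (rank M (G ∪ S)) (begin
      rank M (G ∩ S)                        ≤⟨ rank-≤-card M _ (S⊆E ∘ ∈∩ʳ) ⟩
      ∣ G ∩ S ∣                             ≡⟨ cong ∣_∣ (∩-comm G S) ⟩
      ∣ S ∩ G ∣                             ∎) ⟩
    rank M (G ∪ S) + ∣ S ∩ G ∣            ∎)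
    where open ≤-Reasoning

  flat⇒freeOver : ∀ {G S} → IsFlat M G → S ⊆ E M → ∣ S ─ G ∣ ≤ 1 → FreeOver G S
  flat⇒freeOver {G} {S} (G⊆E , G-closed) S⊆E ∣S─G∣≤1 with nonempty? (S ─ G)
  ... | yes (t , t∈S─G) = begin
    rank M G + ∣ S ─ G ∣   ≤⟨ +-monoʳ-≤ (rank M G) ∣S─G∣≤1 ⟩
    rank M G + 1           ≡⟨ +-comm (rank M G) 1 ⟩
    suc (rank M G)         ≤⟨ G-closed t (S⊆E (∈─ˡ t∈S─G)) (∈─ʳ t∈S─G) ⟩
    rank M (G ∪ ⁅ t ⁆)     ≤⟨ rank-mono M _ _ (∪-lub ∈∪ˡ (∈∪ʳ ∘ ⁅⁆⊆ (∈─ˡ t∈S─G))) (∪-lub G⊆E S⊆E) ⟩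
    rank M (G ∪ S)         ∎
    where open ≤-Reasoning
  ... | no S─G-empty = begin
    rank M G + ∣ S ─ G ∣   ≡⟨ cong (λ D → rank M G + ∣ D ∣) (Empty-unique S─G-empty) ⟩
    rank M G + ∣ ∅ {n} ∣   ≡⟨ cong (rank M G +_) (∣⊥∣≡0 n) ⟩
    rank M G + 0           ≡⟨ +-identityʳ _ ⟩
    rank M G               ≤⟨ rank-mono M _ _ ∈∪ˡ (∪-lub G⊆E S⊆E) ⟩
    rank M (G ∪ S)         ∎
    where open ≤-Reasoning

m≤n⇒m+[n≢m]≡n⊓1+m : ∀ {m n} → m ≤ n → m + (if n ≡ᵇ m then 0 else 1) ≡ n ⊓ suc m
m≤n⇒m+[n≢m]≡n⊓1+m {m} {n} m≤n with n ≡ᵇ m in n≡ᵇm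
... | true  rewrite ≡ᵇ⇒≡ n m (Equivalence.from T-≡ n≡ᵇm) =
  trans (+-identityʳ m) (sym (m≤n⇒m⊓n≡m (n≤1+n m)))
... | false = trans (+-comm m 1) (sym (m≥n⇒m⊓n≡n (≤∧≢⇒< m≤n m≢n)))
  where
  m≢n : m ≢ n
  m≢n refl = contradiction (trans (sym n≡ᵇm) (Equivalence.to T-≡ (≡⇒≡ᵇ m m refl))) λ ()

+-≤-+⇒≤×≤ : ∀ {a b c d} → a + b ≤ c + d → c ≤ a → d ≤ b → a ≤ c × b ≤ d
+-≤-+⇒≤×≤ {a} {b} {c} {d} a+b≤c+d c≤a d≤b =
  +-cancelʳ-≤ b a c (≤-trans a+b≤c+d (+-monoʳ-≤ c d≤b)) ,
  +-cancelˡ-≤ c b d (≤-trans (+-monoˡ-≤ b c≤a) a+b≤c+d)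

infix 4 _⊆₃_
_⊆₃_ : Sub3 n → Sub3 n → Set
Z ⊆₃ Z′ = o Z ⊆ o Z′ × s Z ⊆ s Z′ × q Z ⊆ q Z′

Monotone₃ : (Sub3 n → ℕ) → Set
Monotone₃ {n} r = ∀ {Z Z′ : Sub3 n} → Z ⊆₃ Z′ → r Z ≤ r Z′

⊆₃-trans : ∀ {Z Z′ Z″ : Sub3 n} → Z ⊆₃ Z′ → Z′ ⊆₃ Z″ → Z ⊆₃ Z″
⊆₃-trans (o⊆ , s⊆ , q⊆) (o⊆′ , s⊆′ , q⊆′) = o⊆′ ∘ o⊆ , s⊆′ ∘ s⊆ , q⊆′ ∘ q⊆

⊆₃-∪₃ˡ : ∀ {Z Z′ : Sub3 n} → Z ⊆₃ Z ∪₃ Z′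
⊆₃-∪₃ˡ = ∈∪ˡ , ∈∪ˡ , ∈∪ˡ

∪₃-monoˡ : ∀ {Z Z′ Y : Sub3 n} → Z ⊆₃ Z′ → Z ∪₃ Y ⊆₃ Z′ ∪₃ Y
∪₃-monoˡ (o⊆ , s⊆ , q⊆) = ∪-lub (∈∪ˡ ∘ o⊆) ∈∪ʳ , ∪-lub (∈∪ˡ ∘ s⊆) ∈∪ʳ , ∪-lub (∈∪ˡ ∘ q⊆) ∈∪ʳ

deleteQ : Fin n → Sub3 n → Sub3 n
deleteQ t Z = ⟨ o Z , s Z , q Z - t ⟩

deleteQ-mono : ∀ {t} {Z Z′ : Sub3 n} → Z ⊆₃ Z′ → deleteQ t Z ⊆₃ deleteQ t Z′
deleteQ-mono (o⊆ , s⊆ , q⊆) = o⊆ , s⊆ , λ x∈ → let x∈q , x≢t = ∈-⁻ x∈ in x∈p∧x≢y⇒x∈p-y (q⊆ x∈q) x≢t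

⊆₃-deleteQ : ∀ {t} {Z Z′ : Sub3 n} → t ∉ q Z → Z ⊆₃ Z′ → Z ⊆₃ deleteQ t Z′
⊆₃-deleteQ t∉ (o⊆ , s⊆ , q⊆) = o⊆ , s⊆ , λ x∈ → x∈p∧x≢y⇒x∈p-y (q⊆ x∈) (λ { refl → t∉ x∈ })

module BondRank {n} (M N : Matroid n) where
  open Bonding M N using (r₀; E₀; cl₀; Xflat; ext)

  N-part : Sub3 n → Subset n
  N-part Z = (o Z ∩ (E N ─ T M N)) ∪ (s Z ∩ T M N)

  N-part⊆E : ∀ Z → N-part Z ⊆ E N
  N-part⊆E Z = ∪-lub (∈─ˡ ∘ ∈∩ʳ) (∈∩ʳ ∘ ∈∩ʳ)

  N-part-mono : ∀ {Z Z′} → o Z ⊆ o Z′ → s Z ⊆ s Z′ → N-part Z ⊆ N-part Z′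
  N-part-mono o⊆ s⊆ = ∪-lub (λ x∈ → ∈∪ˡ (∈∩⁺ (o⊆ (∈∩ˡ x∈)) (∈∩ʳ x∈)))
                            (λ x∈ → ∈∪ʳ (∈∩⁺ (s⊆ (∈∩ˡ x∈)) (∈∩ʳ x∈)))

  r₀-mono : ∀ {Z Z′} → o Z ⊆ o Z′ → s Z ⊆ s Z′ → r₀ Z ≤ r₀ Z′
  r₀-mono {Z} {Z′} o⊆ s⊆ =
    +-mono-≤ (rank-mono M _ _ (λ x∈ → ∈∩⁺ (o⊆ (∈∩ˡ x∈)) (∈∩ʳ x∈)) (p∩q⊆q (o Z′) (E M)))
             (rank-mono N _ _ (N-part-mono {Z} {Z′} o⊆ s⊆) (N-part⊆E Z′))

  r₀-∪⁅⁆-o : ∀ {O S Q t} → t ∈ T M N → r₀ ⟨ O ∪ ⁅ t ⁆ , S , Q ⟩ ≤ suc (r₀ ⟨ O , S , Q ⟩)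
  r₀-∪⁅⁆-o {O} {S} {Q} {t} t∈T = +-mono-≤
    (≤-trans (rank-mono M _ _ O∪t∩E⊆ (∪-lub ∈∩ʳ (⁅⁆⊆ (∈∩ˡ t∈T))))
             (rank-∪⁅⁆ M {X = O ∩ E M} ∈∩ʳ (∈∩ˡ t∈T)))
    (rank-mono N _ _ N-part-unchanged (N-part⊆E ⟨ O , S , Q ⟩))
    where
    O∪t∩E⊆ : (O ∪ ⁅ t ⁆) ∩ E M ⊆ (O ∩ E M) ∪ ⁅ t ⁆
    O∪t∩E⊆ x∈ with ∈∪⁻ (∈∩ˡ x∈)
    ... | inj₁ x∈O = ∈∪ˡ (∈∩⁺ x∈O (∈∩ʳ x∈))
    ... | inj₂ x≡t = ∈∪ʳ x≡t
    N-part-unchanged : N-part ⟨ O ∪ ⁅ t ⁆ , S , Q ⟩ ⊆ N-part ⟨ O , S , Q ⟩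
    N-part-unchanged x∈ with ∈∪⁻ x∈
    ... | inj₂ x∈S∩T = ∈∪ʳ x∈S∩T
    ... | inj₁ x∈O∪t∖T with ∈∪⁻ (∈∩ˡ x∈O∪t∖T)
    ...   | inj₁ x∈O = ∈∪ˡ (∈∩⁺ x∈O (∈∩ʳ x∈O∪t∖T))
    ...   | inj₂ x∈t = contradiction (⁅⁆⊆ t∈T x∈t) (∈─ʳ (∈∩ʳ x∈O∪t∖T))

  r₀-∪⁅⁆-s : ∀ {O S Q t} → t ∈ T M N → r₀ ⟨ O , S ∪ ⁅ t ⁆ , Q ⟩ ≤ suc (r₀ ⟨ O , S , Q ⟩)
  r₀-∪⁅⁆-s {O} {S} {Q} {t} t∈T = begin
    rank M (O ∩ E M) + rank N (N-part ⟨ O , S ∪ ⁅ t ⁆ , Q ⟩)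
      ≤⟨ +-monoʳ-≤ (rank M (O ∩ E M)) (≤-trans
           (rank-mono N _ _ N-part-grows (∪-lub (N-part⊆E ⟨ O , S , Q ⟩) (⁅⁆⊆ (∈∩ʳ t∈T))))
           (rank-∪⁅⁆ N (N-part⊆E ⟨ O , S , Q ⟩) (∈∩ʳ t∈T))) ⟩
    rank M (O ∩ E M) + suc (rank N (N-part ⟨ O , S , Q ⟩))
      ≡⟨ +-suc (rank M (O ∩ E M)) _ ⟩
    suc (r₀ ⟨ O , S , Q ⟩) ∎
    where
    open ≤-Reasoning
    N-part-grows : N-part ⟨ O , S ∪ ⁅ t ⁆ , Q ⟩ ⊆ N-part ⟨ O , S , Q ⟩ ∪ ⁅ t ⁆
    N-part-grows x∈ with ∈∪⁻ x∈
    ... | inj₁ x∈O∖T = ∈∪ˡ (∈∪ˡ x∈O∖T)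
    ... | inj₂ x∈S∪t∩T with ∈∪⁻ (∈∩ˡ x∈S∪t∩T)
    ...   | inj₁ x∈S = ∈∪ˡ (∈∪ʳ (∈∩⁺ x∈S (∈∩ʳ x∈S∪t∩T)))
    ...   | inj₂ x∈t = ∈∪ʳ x∈t

  r₀-∪-delete : ∀ {O S A B t} → t ∈ T M N → (∀ {x} → x ∈ A → x ∉ B) →
                r₀ ⟨ O ∪ A , S ∪ B , ∅ ⟩ ≤ suc (r₀ ⟨ O ∪ (A - t) , S ∪ (B - t) , ∅ ⟩)
  r₀-∪-delete {O} {S} {A} {B} {t} t∈T disjoint with t ∈? A
  ... | yes t∈A = ≤-trans
    (r₀-mono {⟨ O ∪ A , S ∪ B , ∅ ⟩} {⟨ (O ∪ (A - t)) ∪ ⁅ t ⁆ , S ∪ (B - t) , ∅ ⟩}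
             ∪⊆[∪-]∪⁅⁆ (∪⊆∪- (disjoint t∈A)))
    (r₀-∪⁅⁆-o {Q = ∅} t∈T)
  ... | no t∉A = ≤-trans
    (r₀-mono {⟨ O ∪ A , S ∪ B , ∅ ⟩} {⟨ O ∪ (A - t) , (S ∪ (B - t)) ∪ ⁅ t ⁆ , ∅ ⟩}
             (∪⊆∪- t∉A) ∪⊆[∪-]∪⁅⁆)
    (r₀-∪⁅⁆-s {Q = ∅} t∈T)

  r₀-absorb : ∀ {Z Y} → o Y ⊆ o Z → s Y ⊆ s Z → r₀ (Z ∪₃ Y) ≡ r₀ Z
  r₀-absorb {Z} {Y} Y⊆Zₒ Y⊆Zₛ =
    ≤-antisym (r₀-mono {Z ∪₃ Y} {Z} (∪-lub (λ x∈ → x∈) Y⊆Zₒ) (∪-lub (λ x∈ → x∈) Y⊆Zₛ))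
              (r₀-mono {Z} {Z ∪₃ Y} ∈∪ˡ ∈∪ˡ)

  ext-∉ : ∀ r {t Z} → t ∉ q Z → ext r t Z ≡ r Z
  ext-∉ r {t} {Z} t∉ with lookup (q Z) t in t∈?
  ... | false = refl
  ... | true  = contradiction (lookup⇒[]= t (q Z) t∈?) t∉

  ext-∈ : ∀ {r} → Monotone₃ r → ∀ {t Z} → t ∈ q Z →
          ext r t Z ≡ r (deleteQ t Z ∪₃ Xflat t) ⊓ suc (r (deleteQ t Z))
  ext-∈ r-mono {t} {Z} t∈ with lookup (q Z) t in t∈?
  ... | true  = m≤n⇒m+[n≢m]≡n⊓1+m (r-mono ⊆₃-∪₃ˡ)
  ... | false = contradiction (trans (sym ([]=⇒lookup t∈)) t∈?) λ ()

  ext-mono : ∀ {r} → Monotone₃ r → ∀ t → Monotone₃ (ext r t)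
  ext-mono {r} r-mono t {Z} {Z′} Z⊆Z′@(_ , _ , q⊆) with t ∈? q Z | t ∈? q Z′
  ... | yes t∈Z | yes t∈Z′ = subst₂ _≤_ (sym (ext-∈ r-mono t∈Z)) (sym (ext-∈ r-mono t∈Z′))
    (⊓-mono-≤ (r-mono (∪₃-monoˡ (deleteQ-mono Z⊆Z′))) (s≤s (r-mono (deleteQ-mono Z⊆Z′))))
  ... | yes t∈Z | no t∉Z′ = contradiction (q⊆ t∈Z) t∉Z′
  ... | no t∉Z  | yes t∈Z′ = subst₂ _≤_ (sym (ext-∉ r t∉Z)) (sym (ext-∈ r-mono t∈Z′))
    (⊓-glb (r-mono (⊆₃-trans (⊆₃-deleteQ t∉Z Z⊆Z′) ⊆₃-∪₃ˡ))
           (m≤n⇒m≤1+n (r-mono (⊆₃-deleteQ t∉Z Z⊆Z′))))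
  ... | no t∉Z  | no t∉Z′ = subst₂ _≤_ (sym (ext-∉ r t∉Z)) (sym (ext-∉ r t∉Z′)) (r-mono Z⊆Z′)

  rH-on : List (Fin n) → Sub3 n → ℕ
  rH-on = foldr (λ t r → if lookup (T M N) t then ext r t else r) r₀

  rH-on-mono : ∀ L → Monotone₃ (rH-on L)
  rH-on-mono [] {Z} {Z′} (o⊆ , s⊆ , _) = r₀-mono {Z} {Z′} o⊆ s⊆
  rH-on-mono (t ∷ L) with lookup (T M N) t
  ... | true  = ext-mono (rH-on-mono L) t
  ... | false = rH-on-mono L

  addₒ addₛ : Fin n → Sub3 n → Sub3 n
  addₒ i Z = Z ∪₃ ⟨ ⁅ i ⁆ , ∅ , ∅ ⟩
  addₛ i Z = Z ∪₃ ⟨ ∅ , ⁅ i ⁆ , ∅ ⟩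

  ∈-cl₀ₒ⁻ : ∀ {Z i} → i ∈ o (cl₀ Z) → i ∈ o E₀ × r₀ (addₒ i Z) ≡ r₀ Z
  ∈-cl₀ₒ⁻ {Z} = ∈-tabulate-≡ᵇ {f = λ i → r₀ (addₒ i Z)}

  ∈-cl₀ₛ⁻ : ∀ {Z i} → i ∈ s (cl₀ Z) → i ∈ s E₀ × r₀ (addₛ i Z) ≡ r₀ Z
  ∈-cl₀ₛ⁻ {Z} = ∈-tabulate-≡ᵇ {f = λ i → r₀ (addₛ i Z)}

  ∈-cl₀ₒ⁺ : ∀ {Z i} → i ∈ o E₀ → r₀ (addₒ i Z) ≡ r₀ Z → i ∈ o (cl₀ Z)
  ∈-cl₀ₒ⁺ {Z} = ∈-tabulate-≡ᵇ⁺ {f = λ i → r₀ (addₒ i Z)}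

  ∈-cl₀ₛ⁺ : ∀ {Z i} → i ∈ s E₀ → r₀ (addₛ i Z) ≡ r₀ Z → i ∈ s (cl₀ Z)
  ∈-cl₀ₛ⁺ {Z} = ∈-tabulate-≡ᵇ⁺ {f = λ i → r₀ (addₛ i Z)}

  X-generators : Fin n → Sub3 n
  X-generators t = ⟨ ⁅ t ⁆ , ⁅ t ⁆ , ∅ ⟩

  t∈Xflat : ∀ {t} → t ∈ T M N → t ∈ o (Xflat t) × t ∈ s (Xflat t)
  t∈Xflat {t} t∈T =
    ∈-cl₀ₒ⁺ {X-generators t} (∈∪ˡ (∈∩ˡ t∈T)) (r₀-absorb {X-generators t} {⟨ ⁅ t ⁆ , ∅ , ∅ ⟩} (λ x∈ → x∈) (⊥-elim ∘ ∉⊥)) ,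
    ∈-cl₀ₛ⁺ {X-generators t} t∈T (r₀-absorb {X-generators t} {⟨ ∅ , ⁅ t ⁆ , ∅ ⟩} (⊥-elim ∘ ∉⊥) (λ x∈ → x∈))

  module _ {F : Subset n} (F-flatₘ : IsFlat M (F ∩ E M)) (F-flatₙ : IsFlat N (F ∩ E N)) where

    r₀-tight⇒⊆F : ∀ {t Z} → t ∈ F → ⁅ t ⁆ ⊆ o Z → ⁅ t ⁆ ⊆ s Z → r₀ Z ≤ r₀ (X-generators t) →
                  o Z ∩ E M ⊆ F × N-part Z ⊆ F
    r₀-tight⇒⊆F {t} {Z} t∈F t⊆o t⊆s r₀Z≤ =
      p∩q⊆p F (E M) ∘ flat-absorbs M F-flatₘ tᴹ⊆F (λ x∈ → ∈∩⁺ (t⊆o (∈∩ˡ x∈)) (∈∩ʳ x∈))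
                                     (p∩q⊆q (o Z) (E M)) (proj₁ ranks≤) ,
      p∩q⊆p F (E N) ∘ flat-absorbs N F-flatₙ tᴺ⊆F (N-part-mono {X-generators t} {Z} t⊆o t⊆s)
                                     (N-part⊆E Z) (proj₂ ranks≤)
      where
      t⊆F : ⁅ t ⁆ ⊆ F
      t⊆F = ⁅⁆⊆ t∈F
      tᴹ⊆F : ⁅ t ⁆ ∩ E M ⊆ F ∩ E M
      tᴹ⊆F x∈ = ∈∩⁺ (t⊆F (∈∩ˡ x∈)) (∈∩ʳ x∈)
      tᴺ⊆F : N-part (X-generators t) ⊆ F ∩ E N
      tᴺ⊆F x∈ = ∈∩⁺ (∪-lub (t⊆F ∘ ∈∩ˡ) (t⊆F ∘ ∈∩ˡ) x∈) (N-part⊆E (X-generators t) x∈)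
      ranks≤ : rank M (o Z ∩ E M) ≤ rank M (⁅ t ⁆ ∩ E M) ×
               rank N (N-part Z) ≤ rank N (N-part (X-generators t))
      ranks≤ = +-≤-+⇒≤×≤ r₀Z≤
        (rank-mono M _ _ (λ x∈ → ∈∩⁺ (t⊆o (∈∩ˡ x∈)) (∈∩ʳ x∈)) (p∩q⊆q (o Z) (E M)))
        (rank-mono N _ _ (N-part-mono {X-generators t} {Z} t⊆o t⊆s) (N-part⊆E Z))

    Xflat⊆F : ∀ {t} → t ∈ F → o (Xflat t) ⊆ F × s (Xflat t) ⊆ F
    Xflat⊆F {t} t∈F = o⊆F , s⊆F
      where
      o⊆F : o (Xflat t) ⊆ F
      o⊆F {i} i∈ =
        let i∈E , r₀≡ = ∈-cl₀ₒ⁻ {X-generators t} i∈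
            tightₘ , tightₙ = r₀-tight⇒⊆F {Z = addₒ i (X-generators t)} t∈F ∈∪ˡ ∈∪ˡ (≤-reflexive r₀≡)
        in [ (λ i∈Eₘ → tightₘ (∈∩⁺ (∈∪ʳ (x∈⁅x⁆ i)) i∈Eₘ))
           , (λ i∈Eₙ∖T → tightₙ (∈∪ˡ (∈∩⁺ (∈∪ʳ (x∈⁅x⁆ i)) i∈Eₙ∖T))) ]′ (∈∪⁻ i∈E)
      s⊆F : s (Xflat t) ⊆ F
      s⊆F {i} i∈ =
        let i∈T , r₀≡ = ∈-cl₀ₛ⁻ {X-generators t} i∈
            _ , tightₙ = r₀-tight⇒⊆F {Z = addₛ i (X-generators t)} t∈F ∈∪ˡ ∈∪ˡ (≤-reflexive r₀≡)
        in tightₙ (∈∪ʳ (∈∩⁺ (∈∪ʳ (x∈⁅x⁆ i)) i∈T))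

    rH-on-upper : ∀ L {Z} → o Z ⊆ F → s Z ⊆ F → rH-on L Z ≤ r₀ ⟨ F , F , ∅ ⟩ + ∣ q Z ─ F ∣
    rH-on-upper [] {Z} o⊆F s⊆F = ≤-trans (r₀-mono {Z} {⟨ F , F , ∅ ⟩} o⊆F s⊆F) (m≤m+n _ _)
    rH-on-upper (t ∷ L) {Z} o⊆F s⊆F with lookup (T M N) t
    ... | false = rH-on-upper L o⊆F s⊆F
    ... | true with t ∈? q Z
    ...   | no t∉q = subst (_≤ _) (sym (ext-∉ (rH-on L) t∉q)) (rH-on-upper L o⊆F s⊆F)
    ...   | yes t∈q = subst (_≤ _) (sym (ext-∈ (rH-on-mono L) t∈q)) (bound (t ∈? F))
      where
      open ≤-Reasoning
      K : ℕ
      K = r₀ ⟨ F , F , ∅ ⟩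
      bound : Dec (t ∈ F) →
              rH-on L (deleteQ t Z ∪₃ Xflat t) ⊓ suc (rH-on L (deleteQ t Z)) ≤ K + ∣ q Z ─ F ∣
      bound (yes t∈F) = begin
        rH-on L (deleteQ t Z ∪₃ Xflat t) ⊓ _  ≤⟨ m⊓n≤m _ _ ⟩
        rH-on L (deleteQ t Z ∪₃ Xflat t)      ≤⟨ rH-on-upper L (∪-lub o⊆F (proj₁ (Xflat⊆F t∈F)))
                                                                (∪-lub s⊆F (proj₂ (Xflat⊆F t∈F))) ⟩
        K + ∣ ((q Z - t) ∪ ∅) ─ F ∣           ≤⟨ +-monoʳ-≤ K (∣p─r∣≤∣q─r∣ ((q Z - t) ∪ ∅) (q Z) F
                                                   (∪-lub (p─q⊆p (q Z) ⁅ t ⁆) (⊥-elim ∘ ∉⊥))) ⟩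
        K + ∣ q Z ─ F ∣                       ∎
      bound (no t∉F) = begin
        _ ⊓ suc (rH-on L (deleteQ t Z))       ≤⟨ m⊓n≤n _ _ ⟩
        suc (rH-on L (deleteQ t Z))           ≤⟨ s≤s (rH-on-upper L o⊆F s⊆F) ⟩
        suc (K + ∣ (q Z - t) ─ F ∣)           ≡⟨ sym (+-suc K _) ⟩
        K + suc ∣ (q Z - t) ─ F ∣             ≤⟨ +-monoʳ-≤ K (∣p-x─q∣<∣p─q∣ (q Z) F t∈q t∉F) ⟩
        K + ∣ q Z ─ F ∣                       ∎

  -- Elements of A (resp. B) are those t whose q_t in Z is to be traded for t (resp. s_t).
  record Pending (L : List (Fin n)) (Z : Sub3 n) (A : Subset n) : Set where
    constructor pending
    field ∈Pending : ∀ {x} → x ∈ A → x ∈ q Z × x ∈ T M N × x ∈ₗ L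
  open Pending

  Pending-tail : ∀ {t L Z A} → (∀ {x} → x ∈ q Z → x ∈ T M N → x ≢ t) →
                 Pending (t ∷ L) Z A → Pending L Z A
  Pending-tail ≢t P = pending λ x∈A → case ∈Pending P x∈A of λ where
    (x∈q , x∈T , here x≡t)  → contradiction x≡t (≢t x∈q x∈T)
    (x∈q , x∈T , there x∈L) → x∈q , x∈T , x∈L

  Pending-deleteQ : ∀ {t L Z A} → Pending (t ∷ L) Z A → Pending L (deleteQ t Z) (A - t)
  Pending-deleteQ {A = A} P = pending λ x∈A-t →
    let x∈A , x≢t = ∈-⁻ {A = A} x∈A-t in
    case ∈Pending P x∈A of λ where
      (_ , _ , here x≡t) → contradiction x≡t x≢t
      (x∈q , x∈T , there x∈L) → x∈p∧x≢y⇒x∈p-y x∈q x≢t , x∈T , x∈L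

  Pending-∪₃ : ∀ {L Z Y A} → Pending L Z A → Pending L (Z ∪₃ Y) A
  Pending-∪₃ P = pending λ x∈A → let x∈q , x∈T , x∈L = ∈Pending P x∈A in ∈∪ˡ x∈q , x∈T , x∈L

  rH-on-lower : ∀ L {Z A B} → Pending L Z A → Pending L Z B → (∀ {x} → x ∈ A → x ∉ B) →
                r₀ ⟨ o Z ∪ A , s Z ∪ B , ∅ ⟩ ≤ rH-on L Z
  rH-on-lower [] {Z} pendingA pendingB _ = r₀-mono {⟨ _ , _ , ∅ ⟩} {Z}
    (∪-lub (λ x∈ → x∈) (⊥-elim ∘ ¬Any[] ∘ proj₂ ∘ proj₂ ∘ ∈Pending pendingA))
    (∪-lub (λ x∈ → x∈) (⊥-elim ∘ ¬Any[] ∘ proj₂ ∘ proj₂ ∘ ∈Pending pendingB))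
  rH-on-lower (t ∷ L) {Z} {A} {B} pendingA pendingB disjoint with lookup (T M N) t in t∈T?
  ... | false = rH-on-lower L (Pending-tail ≢t pendingA) (Pending-tail ≢t pendingB) disjoint
    where
    ≢t : ∀ {x} → x ∈ q Z → x ∈ T M N → x ≢ t
    ≢t _ x∈T refl = contradiction (trans (sym ([]=⇒lookup x∈T)) t∈T?) λ ()
  ... | true with t ∈? q Z
  ...   | no t∉q = subst (_ ≤_) (sym (ext-∉ (rH-on L) t∉q))
    (rH-on-lower L (Pending-tail ≢t pendingA) (Pending-tail ≢t pendingB) disjoint)
    where
    ≢t : ∀ {x} → x ∈ q Z → x ∈ T M N → x ≢ t
    ≢t x∈q _ refl = t∉q x∈q
  ...   | yes t∈q = subst (_ ≤_) (sym (ext-∈ (rH-on-mono L) t∈q)) (⊓-glb via-Xflat via-deletion)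
    where
    t∈T : t ∈ T M N
    t∈T = lookup⇒[]= t (T M N) t∈T?
    disjoint′ : ∀ {x} → x ∈ A - t → x ∉ B - t
    disjoint′ x∈A x∈B = disjoint (∈─ˡ x∈A) (∈─ˡ x∈B)
    via-Xflat : r₀ ⟨ o Z ∪ A , s Z ∪ B , ∅ ⟩ ≤ rH-on L (deleteQ t Z ∪₃ Xflat t)
    via-Xflat = ≤-trans
      (r₀-mono {⟨ o Z ∪ A , s Z ∪ B , ∅ ⟩} {⟨ (o Z ∪ o (Xflat t)) ∪ (A - t) , (s Z ∪ s (Xflat t)) ∪ (B - t) , ∅ ⟩}
               (∪⊆[∪∪]∪- (proj₁ (t∈Xflat t∈T))) (∪⊆[∪∪]∪- (proj₂ (t∈Xflat t∈T))))
      (rH-on-lower L (Pending-∪₃ (Pending-deleteQ pendingA)) (Pending-∪₃ (Pending-deleteQ pendingB)) disjoint′)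
    via-deletion : r₀ ⟨ o Z ∪ A , s Z ∪ B , ∅ ⟩ ≤ suc (rH-on L (deleteQ t Z))
    via-deletion = ≤-trans (r₀-∪-delete t∈T disjoint)
      (s≤s (rH-on-lower L (Pending-deleteQ pendingA) (Pending-deleteQ pendingB) disjoint′))

  ⊆N-part : ∀ {X Z} → X ⊆ E N → (∀ {x} → x ∈ X → x ∉ T M N → x ∈ o Z) →
            (∀ {x} → x ∈ X → x ∈ T M N → x ∈ s Z) → X ⊆ N-part Z
  ⊆N-part X⊆E ⊆o ⊆s {x} x∈X with x ∈? T M N
  ... | yes x∈T = ∈∪ʳ (∈∩⁺ (⊆s x∈X x∈T) x∈T)
  ... | no  x∉T = ∈∪ˡ (∈∩⁺ (⊆o x∈X x∉T) (x∈p∧x∉q⇒x∈p─q (X⊆E x∈X) x∉T))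

module BondFlat {n} (M N : Matroid n) {F : Subset n} (F⊆E : F ⊆ EB M N)
                (F-flatₘ : IsFlat M (F ∩ E M)) (F-flatₙ : IsFlat N (F ∩ E N)) where
  open Bonding M N using (r₀; rH)
  open BondRank M N

  ρₘ ρₙ δ : ℕ
  ρₘ = rank M (F ∩ E M)
  ρₙ = rank N (F ∩ E N)
  δ  = ∣ T M N ─ F ∣

  freeOver⇒gain : ∀ X {G} → G ⊆ F → FreeOver X G (T M N) → rank X G + δ ≤ rank X (G ∪ T M N)
  freeOver⇒gain X {G} G⊆F = ≤-trans (+-monoʳ-≤ (rank X G)
    (p⊆q⇒∣p∣≤∣q∣ {p = T M N ─ F} {q = T M N ─ G} λ x∈ → x∈p∧x∉q⇒x∈p─q (∈─ˡ x∈) (∈─ʳ x∈ ∘ G⊆F)))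

  rH-F≤ : rH ⟨ F ∩ EB M N , ∅ , T M N ⟩ ≤ ρₘ + ρₙ + δ
  rH-F≤ = ≤-trans (rH-on-upper F-flatₘ F-flatₙ (allFin n) (p∩q⊆p F (EB M N)) (⊥-elim ∘ ∉⊥))
    (+-monoˡ-≤ δ (+-monoʳ-≤ ρₘ (rank-mono N _ _
      (∪-lub (λ x∈ → ∈∩⁺ (∈∩ˡ x∈) (∈─ˡ (∈∩ʳ x∈))) (λ x∈ → ∈∩⁺ (∈∩ˡ x∈) (∈∩ʳ (∈∩ʳ x∈))))
      (p∩q⊆q F (E N)))))

  Zₑ : Fin n → Sub3 n
  Zₑ e = ⟨ (F ∪ ⁅ e ⁆) ∩ EB M N , ∅ , T M N ⟩

  F∪e⊆oZₑ : ∀ {e x} → e ∈ EB M N → x ∈ F ∪ ⁅ e ⁆ → x ∈ o (Zₑ e)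
  F∪e⊆oZₑ e∈E x∈ = ∈∩⁺ x∈ (∪-lub F⊆E (⁅⁆⊆ e∈E) x∈)

  F∩G∪e⊆F∪e : ∀ {e G} → (F ∩ G) ∪ ⁅ e ⁆ ⊆ F ∪ ⁅ e ⁆
  F∩G∪e⊆F∪e = ∪-lub (∈∪ˡ ∘ ∈∩ˡ) ∈∪ʳ

  r₀-trade≤rH : ∀ e {A B} → A ⊆ T M N → B ⊆ T M N → (∀ {x} → x ∈ A → x ∉ B) →
                r₀ ⟨ o (Zₑ e) ∪ A , s (Zₑ e) ∪ B , ∅ ⟩ ≤ rH (Zₑ e)
  r₀-trade≤rH e A⊆T B⊆T = rH-on-lower (allFin n) (pending-⊆T A⊆T) (pending-⊆T B⊆T)
    where
    pending-⊆T : ∀ {A} → A ⊆ T M N → Pending (allFin n) (Zₑ e) A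
    pending-⊆T A⊆T = pending λ {x} x∈A → A⊆T x∈A , A⊆T x∈A , ∈-allFin x

  bound<rH-∈Eₘ : FreeOver N (F ∩ E N) (T M N) → ∀ {e} → e ∈ EB M N → e ∉ F → e ∈ E M →
                 ρₘ + ρₙ + δ < rH (Zₑ e)
  bound<rH-∈Eₘ freeₙ {e} e∈E e∉F e∈Eₘ = begin-strict
    ρₘ + ρₙ + δ                              ≡⟨ +-assoc ρₘ ρₙ δ ⟩
    ρₘ + (ρₙ + δ)                            <⟨ +-monoˡ-< (ρₙ + δ) (proj₂ F-flatₘ e e∈Eₘ (e∉F ∘ ∈∩ˡ)) ⟩
    rank M ((F ∩ E M) ∪ ⁅ e ⁆) + (ρₙ + δ)    ≤⟨ +-mono-≤
      (rank-mono M _ _ (λ x∈ → ∈∩⁺ (∈∪ˡ (F∪e⊆oZₑ e∈E (F∩G∪e⊆F∪e x∈))) (∪-lub (p∩q⊆q F (E M)) (⁅⁆⊆ e∈Eₘ) x∈))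
                       (p∩q⊆q _ (E M)))
      (≤-trans (freeOver⇒gain N (p∩q⊆p F (E N)) freeₙ) (rank-mono N _ _
        (⊆N-part {Z = Z⁺} (∪-lub (p∩q⊆q F (E N)) (∈∩ʳ {A = E M}))
                 (λ x∈ x∉T → ∈∪ˡ (F∪e⊆oZₑ e∈E (∈∪ˡ (∈∩ˡ (x∈p∪q∧x∉q⇒x∈p x∈ x∉T)))))
                 (λ _ x∈T → ∈∪ʳ x∈T))
        (N-part⊆E Z⁺))) ⟩
    r₀ Z⁺                                    ≤⟨ r₀-trade≤rH e (⊥-elim ∘ ∉⊥) (λ x∈ → x∈) (λ x∈ → ⊥-elim (∉⊥ x∈)) ⟩
    rH (Zₑ e)                                ∎
    where
    open ≤-Reasoning
    Z⁺ : Sub3 n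
    Z⁺ = ⟨ o (Zₑ e) ∪ ∅ , s (Zₑ e) ∪ T M N , ∅ ⟩

  bound<rH-∉Eₘ : FreeOver M (F ∩ E M) (T M N) → ∀ {e} → e ∈ EB M N → e ∉ F → e ∉ E M →
                 ρₘ + ρₙ + δ < rH (Zₑ e)
  bound<rH-∉Eₘ freeₘ {e} e∈E e∉F e∉Eₘ = begin-strict
    ρₘ + ρₙ + δ                              ≡⟨ +-assoc ρₘ ρₙ δ ⟩
    ρₘ + (ρₙ + δ)                            ≡⟨ cong (ρₘ +_) (+-comm ρₙ δ) ⟩
    ρₘ + (δ + ρₙ)                            ≡⟨ sym (+-assoc ρₘ δ ρₙ) ⟩
    ρₘ + δ + ρₙ                              <⟨ +-monoʳ-< (ρₘ + δ) (proj₂ F-flatₙ e e∈Eₙ (e∉F ∘ ∈∩ˡ)) ⟩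
    ρₘ + δ + rank N ((F ∩ E N) ∪ ⁅ e ⁆)      ≤⟨ +-mono-≤
      (≤-trans (freeOver⇒gain M (p∩q⊆p F (E M)) freeₘ) (rank-mono M _ _
        (∪-lub (λ x∈ → ∈∩⁺ (∈∪ˡ (F∪e⊆oZₑ e∈E (∈∪ˡ (∈∩ˡ x∈)))) (∈∩ʳ x∈)) (λ x∈T → ∈∩⁺ (T⊆oZ⁺ x∈T) (∈∩ˡ x∈T)))
        (p∩q⊆q _ (E M))))
      (rank-mono N _ _
        (⊆N-part {Z = Z⁺} (∪-lub (p∩q⊆q F (E N)) (⁅⁆⊆ e∈Eₙ))
                 (λ x∈ _ → ∈∪ˡ (F∪e⊆oZₑ e∈E (F∩G∪e⊆F∪e x∈)))
                 (λ x∈ x∈T → ∈∪ʳ (∈∩⁺ x∈T (∈∩ˡ (x∈p∪q∧x∉q⇒x∈p x∈ (λ x∈e →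
                    e∉Eₘ (subst (_∈ E M) (x∈⁅y⁆⇒x≡y e x∈e) (∈∩ˡ x∈T))))))))
        (N-part⊆E Z⁺)) ⟩
    r₀ Z⁺                                    ≤⟨ r₀-trade≤rH e (p─q⊆p (T M N) F) (p∩q⊆p (T M N) F)
                                                 (λ x∈ x∈′ → ∈─ʳ x∈ (∈∩ʳ x∈′)) ⟩
    rH (Zₑ e)                                ∎
    where
    open ≤-Reasoning
    Z⁺ : Sub3 n
    Z⁺ = ⟨ o (Zₑ e) ∪ (T M N ─ F) , s (Zₑ e) ∪ (T M N ∩ F) , ∅ ⟩
    e∈Eₙ : e ∈ E N
    e∈Eₙ = [ (λ e∈Eₘ → contradiction e∈Eₘ e∉Eₘ) , (λ e∈Eₙ → e∈Eₙ) ]′ (∈∪⁻ e∈E)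
    T⊆oZ⁺ : ∀ {x} → x ∈ T M N → x ∈ o Z⁺
    T⊆oZ⁺ {x} x∈T with x ∈? F
    ... | yes x∈F = ∈∪ˡ (F∪e⊆oZₑ e∈E (∈∪ˡ x∈F))
    ... | no  x∉F = ∈∪ʳ (x∈p∧x∉q⇒x∈p─q x∈T x∉F)

  bond-flat : FreeOver M (F ∩ E M) (T M N) → FreeOver N (F ∩ E N) (T M N) → IsFlatBond M N F
  bond-flat freeₘ freeₙ = F⊆E , λ e e∈E e∉F →
    ∸-monoˡ-< (≤-<-trans rH-F≤ (bound<rH e∈E e∉F (e ∈? E M)))
              (rH-on-mono (allFin n) ((⊥-elim ∘ ∉⊥) , (λ x∈ → x∈) , (λ x∈ → x∈)))
    where
    bound<rH : ∀ {e} → e ∈ EB M N → e ∉ F → Dec (e ∈ E M) → ρₘ + ρₙ + δ < rH (Zₑ e)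
    bound<rH e∈E e∉F (yes e∈Eₘ) = bound<rH-∈Eₘ freeₙ e∈E e∉F e∈Eₘ
    bound<rH e∈E e∉F (no  e∉Eₘ) = bound<rH-∉Eₘ freeₘ e∈E e∉F e∉Eₘ

lemma4p23 : (n : ℕ) (M N : Matroid n) →
    Nonempty (T M N) →
    Indep M (T M N) → Indep N (T M N) →
    (F : Subset n) → F ⊆ (E M ∪ E N) →
    IsFlat M (F ∩ E M) → IsFlat N (F ∩ E N) →
    ((ModularPair M (F ∩ E M) (T M N) × ModularPair N (F ∩ E N) (T M N)) →
      IsFlatBond M N F)
    × (∣ T M N ─ F ∣ ≤ 1 → IsFlatBond M N F)
lemma4p23 n M N _ T-indₘ T-indₙ F F⊆E F-flatₘ F-flatₙ =
  (λ (modularₘ , modularₙ) → bond-flat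
     (modular⇒freeOver M T-indₘ modularₘ) (modular⇒freeOver N T-indₙ modularₙ)) ,
  (λ ∣T─F∣≤1 → bond-flat
     (flat⇒freeOver M F-flatₘ (proj₁ T-indₘ) (≤-trans (∣p─q∩r∣≤∣p─q∣ (T M N) F (E M) (proj₁ T-indₘ)) ∣T─F∣≤1))
     (flat⇒freeOver N F-flatₙ (proj₁ T-indₙ) (≤-trans (∣p─q∩r∣≤∣p─q∣ (T M N) F (E N) (proj₁ T-indₙ)) ∣T─F∣≤1)))
  where open BondFlat M N F⊆E F-flatₘ F-flatₙ
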